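{- Let $t$ be a positive integer and let $M^<_t$ be the ordered matching on $[2t^2]$ defined as follows: partition $[t^2]$ into consecutive intervals $I_1,\dots,I_t$, each of size $t$, and partition $\{t^2+1,\dots,2t^2\}$ into consecutive intervals $J_1,\dots,J_t$, each of size $t$; for all $i,j\in[t]$ put an edge between the $j$th vertex of $I_i$ and the $i$th vertex of $J_j$. Then for any two intervals $I\subseteq\bigcup_{i=1}^t I_i$ and $J\subseteq\bigcup_{j=1}^t J_j$, each of length at least $2t$, there is at least one edge of $M^<_t$ between $I$ and $J$.
   Context: An ordered matching is a $1$-regular graph with a linear order on its vertices; here the vertex set $[2t^2]=\{1,\dots,2t^2\}$ carries its natural order. An interval is a set of consecutive integers and its length is its cardinality. -}

module Defs where

open import Data.Nat using (ℕ; _+_; _*_; _∸_; _≤_; _<_)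
open import Data.Product using (_×_; ∃-syntax)
open import Data.Sum using (_⊎_)
open import Relation.Binary.PropositionalEquality using (_≡_)

-- Vertices of the ordered matching M^<_t are the natural numbers 1 … 2t²,
-- with their natural order. All indices below are 1-based.

vtxI : ℕ → ℕ → ℕ → ℕ
vtxI t i j = (i ∸ 1) * t + j

vtxJ : ℕ → ℕ → ℕ → ℕ
vtxJ t j i = t * t + (j ∸ 1) * t + i

EdgeIJ : ℕ → ℕ → ℕ → Set
EdgeIJ t u v =
  ∃[ i ] ∃[ j ] ((1 ≤ i × i ≤ t) × (1 ≤ j × j ≤ t) ×
                 u ≡ vtxI t i j × v ≡ vtxJ t j i)

Edge : ℕ → ℕ → ℕ → Set
Edge t u v = EdgeIJ t u v ⊎ EdgeIJ t v u

InInterval : ℕ → ℕ → ℕ → Set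
InInterval a L x = a ≤ x × x < a + L

-- Cutting [t²] into blocks of t consecutive vertices, an interval of length
-- ≥ 2t inside it contains a whole block I_i, and likewise an interval of length
-- ≥ 2t inside {t²+1, …, 2t²} contains a whole block J_j. The edge joining the
-- j-th vertex of I_i to the i-th vertex of J_j then runs between the two intervals.
module Submission where

open import Defs
open import Data.Nat using (ℕ; suc; _+_; _*_; _∸_; _≤_; _<_; z≤n; s≤s; NonZero; >-nonZero)
open import Data.Nat.Properties
open import Data.Nat.DivMod using (_/_; _%_; m≡m%n+[m/n]*n; m%n<n)
open import Data.Product using (_×_; ∃-syntax; _,_)
open import Data.Sum using (inj₁)
open import Relation.Binary.PropositionalEquality using (_≡_; refl; cong; subst)
open import Data.Nat.Solver using (module +-*-Solver)
open +-*-Solver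

-- Blocks are {q t, …, q t + t - 1} (0-based); q = ⌊c/t⌋ + 1 is the first block
-- starting at or after c.
block-⊆-interval : ∀ t m c L .{{_ : NonZero t}} → c + L ≤ m * t → 2 * t ≤ L →
  ∃[ q ] (suc q ≤ m × c ≤ q * t × suc q * t ≤ c + L)
block-⊆-interval t m c L c+L≤mt 2t≤L =
  suc (c / t) , *-cancelʳ-≤ (suc (suc (c / t))) m t (≤-trans end≤ c+L≤mt) , start≤ , end≤
  where
  open ≤-Reasoning
  p = (c / t) * t

  c≡ : c ≡ c % t + p
  c≡ = m≡m%n+[m/n]*n c t

  start≤ : c ≤ t + p
  start≤ = begin
    c          ≡⟨ c≡ ⟩
    c % t + p  ≤⟨ +-monoˡ-≤ p (<⇒≤ (m%n<n c t)) ⟩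
    t + p      ∎

  end≤ : t + (t + p) ≤ c + L
  end≤ = begin
    t + (t + p)        ≡⟨ solve 2 (λ t p → t :+ (t :+ p) := p :+ con 2 :* t) refl t p ⟩
    p + 2 * t          ≤⟨ +-mono-≤ (m≤n+m p (c % t)) 2t≤L ⟩
    (c % t + p) + L    ≡⟨ cong (_+ L) c≡ ⟨
    c + L              ∎

offset-cancel : ∀ o c L n → o + 1 + c + L ≤ o + n + 1 → c + L ≤ n
offset-cancel o c L n le = +-cancelˡ-≤ (o + 1) (c + L) n (begin
  o + 1 + (c + L)  ≡⟨ +-assoc (o + 1) c L ⟨
  o + 1 + c + L    ≤⟨ le ⟩
  o + n + 1        ≡⟨ solve 2 (λ o n → o :+ n :+ con 1 := o :+ con 1 :+ n) refl o n ⟩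
  o + 1 + n        ∎)
  where open ≤-Reasoning

block-⊆-shiftedInterval : ∀ t m o a L .{{_ : NonZero t}} →
  o + 1 ≤ a → a + L ≤ o + m * t + 1 → 2 * t ≤ L →
  ∃[ i ] ((1 ≤ i × i ≤ m) ×
          (∀ j → 1 ≤ j → j ≤ t → InInterval a L (o + (i ∸ 1) * t + j)))
block-⊆-shiftedInterval t m o a L o+1≤a a+L≤ 2t≤L with m≤n⇒∃[o]m+o≡n o+1≤a
... | c , refl with block-⊆-interval t m c L (offset-cancel o c L (m * t) a+L≤) 2t≤L
... | q , q<m , c≤qt , q+1t≤ = suc q , (s≤s z≤n , q<m) , inBlock
  where
  open ≤-Reasoning
  inBlock : ∀ j → 1 ≤ j → j ≤ t → InInterval (o + 1 + c) L (o + q * t + j)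
  inBlock j 1≤j j≤t = lower , upper
    where
    lower : o + 1 + c ≤ o + q * t + j
    lower = begin
      o + 1 + c      ≡⟨ solve 2 (λ o c → o :+ con 1 :+ c := o :+ c :+ con 1) refl o c ⟩
      o + c + 1      ≤⟨ +-mono-≤ (+-monoʳ-≤ o c≤qt) 1≤j ⟩
      o + q * t + j  ∎
    upper : o + q * t + j < o + 1 + c + L
    upper = begin-strict
      o + q * t + j      ≤⟨ +-monoʳ-≤ (o + q * t) j≤t ⟩
      o + q * t + t      ≡⟨ solve 3 (λ o q t → o :+ q :* t :+ t := o :+ (t :+ q :* t)) refl o q t ⟩
      o + suc q * t      ≤⟨ +-monoʳ-≤ o q+1t≤ ⟩
      o + (c + L)        <⟨ n<1+n _ ⟩
      suc (o + (c + L))  ≡⟨ solve 3 (λ o c L → con 1 :+ (o :+ (c :+ L)) := o :+ con 1 :+ c :+ L) refl o c L ⟩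
      o + 1 + c + L      ∎

mainTheorem7 : (t : ℕ) → 1 ≤ t →
    (a L b K : ℕ) →
    1 ≤ a → a + L ≤ t * t + 1 → 2 * t ≤ L →
    t * t + 1 ≤ b → b + K ≤ 2 * (t * t) + 1 → 2 * t ≤ K →
    ∃[ u ] ∃[ v ] (InInterval a L u × InInterval b K v × Edge t u v)
mainTheorem7 t 1≤t a L b K 1≤a a+L≤ 2t≤L t²<b b+K≤ 2t≤K
  with block-⊆-shiftedInterval t t 0 a L {{>-nonZero 1≤t}} 1≤a a+L≤ 2t≤L
     | block-⊆-shiftedInterval t t (t * t) b K {{>-nonZero 1≤t}} t²<b
         (subst (b + K ≤_) (solve 1 (λ x → con 2 :* x :+ con 1 := x :+ x :+ con 1) refl (t * t)) b+K≤) 2t≤K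
... | i , i∈[t]@(1≤i , i≤t) , I-block | j , j∈[t]@(1≤j , j≤t) , J-block =
  vtxI t i j , vtxJ t j i , I-block j 1≤j j≤t , J-block i 1≤i i≤t ,
  inj₁ (i , j , i∈[t] , j∈[t] , refl , refl)
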